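{- Let $j$ be a positive integer and let $n$ be the number of 1's in the binary expansion of $j$. For integers $\alpha\ge\lceil\log_2 j\rceil+2$, $\beta\ge\lceil\log_2 j\rceil+9$, and $\rho\ge\lceil\log_2 j\rceil+8$, define $$k_\alpha=2^{2\alpha}+2^\alpha+2,\qquad K_\beta=2^{2\beta+1}+3\cdot2^{\beta+3}+49,\qquad \kappa_\rho=2^\rho+2,$$ and let $\chi_j(\rho)=2j+1$ if $n+\rho\equiv0\pmod2$ and $\chi_j(\rho)=4j+3$ if $n+\rho\equiv1\pmod 2$. Then $$\Gamma_j(k_\alpha)\ge 3\cdot2^{2\alpha}-2^\alpha+1,\quad \Gamma_j(K_\beta)\ge 3\cdot2^{2\beta+1}-2^{\beta-1}+1,\quad \Gamma_j(\kappa_\rho)\ge 5\cdot2^{\rho-1}-8\chi_j(\rho)+1.$$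
   Context: The Thue–Morse word $\mathbf{t}=\mathbf{t}_1\mathbf{t}_2\mathbf{t}_3\cdots=0110100110010110\cdots$ is the infinite binary word whose $i$-th letter $\mathbf{t}_i$ ($i\ge 1$) is the parity of the number of 1's in the binary expansion of $i-1$. A $k$-anti-power is a word $w^{(1)}\cdots w^{(k)}$ with $w^{(1)},\dots,w^{(k)}$ pairwise distinct words of the same length. For $j\ge0$, the $j$-fix of $\mathbf{t}$ of length $N$ is $\mathbf{t}_{j+1}\cdots\mathbf{t}_{j+N}$. $\mathcal{F}_j(k)$ is the set of odd positive integers $m$ such that the $j$-fix of $\mathbf{t}$ of length $km$ is a $k$-anti-power, and $\Gamma_j(k)=\sup\big((2\mathbb{Z}^+-1)\setminus\mathcal{F}_j(k)\big)$. -}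

module Defs where

open import Data.Nat using (ℕ; zero; suc; _+_; _*_; _∸_; _^_; _≤_; _<_)
open import Data.Nat.DivMod using (_/_; _%_)
open import Data.Nat.Logarithm using (⌈log₂_⌉)
open import Data.Integer as ℤ using (ℤ; +_)
open import Data.Fin using (Fin; toℕ)
open import Data.Vec using (Vec; tabulate)
open import Data.Product using (Σ; ∃; _×_)
open import Relation.Binary.PropositionalEquality using (_≡_; _≢_)
open import Relation.Nullary using (¬_)

-- number of 1's in the binary expansion of n (fuel-based; fuel n suffices)
popcountFuel : ℕ → ℕ → ℕ
popcountFuel zero    _ = 0
popcountFuel (suc f) n = n % 2 + popcountFuel f (n / 2)

popcount : ℕ → ℕ
popcount n = popcountFuel n n

-- 0-indexed Thue–Morse: tm i = 𝐭_{i+1} = parity of popcount i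
tm : ℕ → ℕ
tm i = popcount i % 2

-- the a-th block (0 ≤ a < k) of length m of the j-fix:
-- letters 𝐭_{j + a m + 1} ⋯ 𝐭_{j + a m + m}
block : (j m a : ℕ) → Vec ℕ m
block j m a = tabulate (λ i → tm (j + a * m + toℕ i))

IsAntiPowerFix : (j k m : ℕ) → Set
IsAntiPowerFix j k m = ∀ a b → a < k → b < k → a ≢ b → block j m a ≢ block j m b

InF : (j k m : ℕ) → Set
InF j k m = (m % 2 ≡ 1) × IsAntiPowerFix j k m

-- Γ_j(k) ≥ X, where Γ_j(k) = sup of the odd positive integers not in 𝓕_j(k).
-- For a set of integers, sup S ≥ X iff S has an element ≥ X.
ΓGe : (j k : ℕ) → ℤ → Set
ΓGe j k X = ∃ λ m → (m % 2 ≡ 1) × (¬ InF j k m) × (X ℤ.≤ + m)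

k-α : ℕ → ℕ
k-α α = 2 ^ (2 * α) + 2 ^ α + 2

K-β : ℕ → ℕ
K-β β = 2 ^ (2 * β + 1) + 3 * 2 ^ (β + 3) + 49

κ-ρ : ℕ → ℕ
κ-ρ ρ = 2 ^ ρ + 2

χ-aux : ℕ → ℕ → ℕ
χ-aux zero    j = 2 * j + 1
χ-aux (suc _) j = 4 * j + 3

χ : ℕ → ℕ → ℕ
χ j ρ = χ-aux ((popcount j + ρ) % 2) j

module Submission where

open import Defs
open import Data.Nat using (ℕ; _+_; _*_; _∸_; _^_; _≤_)
open import Data.Nat.Logarithm using (⌈log₂_⌉)
open import Data.Integer as ℤ using (ℤ; +_)
open import Data.Product using (_×_)

open import Data.Nat using (zero; suc; _<_; NonZero; z≤n; s≤s; ⌈_/2⌉)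
open import Data.Nat.Properties
open import Data.Nat.DivMod
open import Data.Nat.Logarithm.Core using (⌈log2⌉)
open import Data.Nat.Induction using (<-wellFounded)
open import Data.Nat.Tactic.RingSolver using (solve-∀)
import Data.Integer.Properties as ℤP
open import Data.Fin using (toℕ)
open import Data.Fin.Properties using (toℕ<n)
open import Data.Vec.Properties using (tabulate-cong)
open import Data.Product using (Σ; _,_; proj₂)
open import Induction.WellFounded using (Acc; acc)
open import Relation.Binary.PropositionalEquality
open import Relation.Nullary using (¬_)

-- Every family of the theorem is handled by exhibiting one odd
-- length m and two block indices a < b < k whose blocks of length m in the
-- j-fix coincide; then m ∉ 𝓕_j(k), so Γ_j(k) ≥ m, and m is exactly the
-- claimed bound.  The coincidence of blocks rests on one fact about the
-- Thue–Morse word: if P is a power of two, then t(P·Q + s) depends, for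
-- s < 3P, only on the three letters t(Q), t(Q+1), t(Q+2) (the "window" of Q),
-- because the binary digit sum is additive on P·q + r with r < P.
-- The file therefore develops: (1) digit-sum identities (halving, additivity
-- over concatenation, complements of 2^s); (2) the window lemma and the
-- resulting criterion for m ∉ 𝓕_j(k); (3) three parametrised families of
-- witnesses, one per claimed bound, with the parameter a power of two
-- dominating j (via j ≤ 2^⌈log₂ j⌉); (4) the translation of the exponents
-- α, β, ρ into these parameters, and the theorem.

≤-by : ∀ {x y} d → x + d ≡ y → x ≤ y
≤-by {x} d eq = m+n≤o⇒m≤o x (≤-reflexive eq)

<-by : ∀ {x y} d → suc (x + d) ≡ y → x < y
<-by {x} d eq = m+n≤o⇒m≤o (suc x) (≤-reflexive eq)

halve-fuel : ∀ f n → n ≤ suc f → n / 2 ≤ f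
halve-fuel f zero _ = z≤n
halve-fuel f (suc n) (s≤s n≤f) = ≤-trans (≤-pred (m/n<m (suc n) 2 (s≤s (s≤s z≤n)))) n≤f

popcountFuel-irrelevant : ∀ f g n → n ≤ f → n ≤ g → popcountFuel f n ≡ popcountFuel g n
popcountFuel-irrelevant zero zero n _ _ = refl
popcountFuel-irrelevant zero (suc g) .zero z≤n _ = popcountFuel-irrelevant zero g 0 z≤n z≤n
popcountFuel-irrelevant (suc f) zero .zero _ z≤n = popcountFuel-irrelevant f zero 0 z≤n z≤n
popcountFuel-irrelevant (suc f) (suc g) n n≤f n≤g =
  cong (_+_ (n % 2)) (popcountFuel-irrelevant f g (n / 2) (halve-fuel f n n≤f) (halve-fuel g n n≤g))

popcount-step : ∀ n → popcount n ≡ n % 2 + popcount (n / 2)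
popcount-step zero = refl
popcount-step (suc n) =
  cong (_+_ (suc n % 2)) (popcountFuel-irrelevant n (suc n / 2) (suc n / 2) (halve-fuel n (suc n) ≤-refl) ≤-refl)

data BitView : ℕ → Set where
  bit : ∀ b k → b < 2 → BitView (b + k * 2)

bitView : ∀ n → BitView n
bitView n = subst BitView (sym (m≡m%n+[m/n]*n n 2)) (bit (n % 2) (n / 2) (m%n<n n 2))

popcount-bit : ∀ b k → b < 2 → popcount (b + k * 2) ≡ b + popcount k
popcount-bit b k b<2 = begin
    popcount n                  ≡⟨ popcount-step n ⟩
    n % 2 + popcount (n / 2)    ≡⟨ cong₂ (λ d q → d + popcount q) last-digit rest ⟩
    b + popcount k              ∎
  where
  open ≡-Reasoning
  n = b + k * 2
  last-digit : n % 2 ≡ b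
  last-digit = trans ([m+kn]%n≡m%n b k 2) (m<n⇒m%n≡m b<2)
  rest : n / 2 ≡ k
  rest = *-cancelʳ-≡ (n / 2) k 2 (+-cancelˡ-≡ b _ _ (sym (begin
    b + k * 2                  ≡⟨⟩
    n                          ≡⟨ m≡m%n+[m/n]*n n 2 ⟩
    n % 2 + (n / 2) * 2        ≡⟨ cong (_+ (n / 2) * 2) last-digit ⟩
    b + (n / 2) * 2            ∎)))

PowerOfTwo : ℕ → Set
PowerOfTwo P = Σ ℕ λ N → 2 ^ N ≡ P

powerOfTwo-* : ∀ {P Q} → PowerOfTwo P → PowerOfTwo Q → PowerOfTwo (P * Q)
powerOfTwo-* (M , refl) (N , refl) = M + N , ^-distribˡ-+-* 2 M N

-- Writing r < 2^N below q concatenates binary expansions, so digit sums add.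
popcount-concat-pow : ∀ N q r → r < 2 ^ N → popcount (2 ^ N * q + r) ≡ popcount q + popcount r
popcount-concat-pow zero q .zero (s≤s z≤n) =
  trans (cong popcount (trans (+-identityʳ _) (*-identityˡ q))) (sym (+-identityʳ _))
popcount-concat-pow (suc N) q r r<2P with bitView r
... | bit b k b<2 = begin
    popcount (2 ^ suc N * q + (b + k * 2))   ≡⟨ cong popcount (shift-digit (2 ^ N) q b k) ⟩
    popcount (b + (2 ^ N * q + k) * 2)       ≡⟨ popcount-bit b (2 ^ N * q + k) b<2 ⟩
    b + popcount (2 ^ N * q + k)             ≡⟨ cong (_+_ b) (popcount-concat-pow N q k k<P) ⟩
    b + (popcount q + popcount k)            ≡⟨ x+[y+z]≡y+[x+z] b (popcount q) (popcount k) ⟩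
    popcount q + (b + popcount k)            ≡⟨ cong (_+_ (popcount q)) (sym (popcount-bit b k b<2)) ⟩
    popcount q + popcount (b + k * 2)        ∎
  where
  open ≡-Reasoning
  shift-digit : ∀ P q b k → 2 * P * q + (b + k * 2) ≡ b + (P * q + k) * 2
  shift-digit = solve-∀
  x+[y+z]≡y+[x+z] : ∀ x y z → x + (y + z) ≡ y + (x + z)
  x+[y+z]≡y+[x+z] = solve-∀
  k<P : k < 2 ^ N
  k<P = *-cancelʳ-< _ k (2 ^ N)
          (≤-trans (s≤s (m≤n+m (k * 2) b)) (≤-trans r<2P (≤-reflexive (*-comm 2 (2 ^ N)))))

popcount-concat : ∀ {P} q r → PowerOfTwo P → r < P → popcount (P * q + r) ≡ popcount q + popcount r
popcount-concat q r (N , refl) = popcount-concat-pow N q r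

-- Two numbers adding up to 2^s − 1 have complementary binary digits.
popcount-complement : ∀ s y z → y + z + 1 ≡ 2 ^ s → popcount y + popcount z ≡ s
popcount-complement zero y z eq
  with m+n≡0⇒m≡0 y y+z≡0 | m+n≡0⇒n≡0 y y+z≡0
  where
  y+z≡0 : y + z ≡ 0
  y+z≡0 = +-cancelʳ-≡ 1 (y + z) 0 eq
... | refl | refl = refl
popcount-complement (suc s) y z eq with bitView y | bitView z
... | bit b k b<2 | bit c l c<2 = begin
    popcount (b + k * 2) + popcount (c + l * 2)     ≡⟨ cong₂ _+_ (popcount-bit b k b<2) (popcount-bit c l c<2) ⟩
    (b + popcount k) + (c + popcount l)             ≡⟨ interchange b (popcount k) c (popcount l) ⟩
    (b + c) + (popcount k + popcount l)             ≡⟨ cong₂ _+_ digits-sum-to-1 (popcount-complement s k l higher) ⟩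
    1 + s                                           ∎
  where
  open ≡-Reasoning
  interchange : ∀ a b c d → (a + b) + (c + d) ≡ (a + c) + (b + d)
  interchange = solve-∀
  regroup : ∀ b c k l → b + k * 2 + (c + l * 2) + 1 ≡ (b + c + 1) + (k + l) * 2
  regroup = solve-∀
  total : (b + c + 1) + (k + l) * 2 ≡ 2 ^ s * 2
  total = trans (sym (regroup b c k l)) (trans eq (*-comm 2 (2 ^ s)))
  last-even : (b + c + 1) % 2 ≡ 0
  last-even = trans (sym ([m+kn]%n≡m%n (b + c + 1) (k + l) 2)) (trans (cong (_% 2) total) (m*n%n≡0 (2 ^ s) 2))
  digits-sum-to-1 : b + c ≡ 1
  digits-sum-to-1 = lemma b c b<2 c<2 last-even
    where
    lemma : ∀ b c → b < 2 → c < 2 → (b + c + 1) % 2 ≡ 0 → b + c ≡ 1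
    lemma 0 1 _ _ _ = refl
    lemma 1 0 _ _ _ = refl
    lemma 0 0 _ _ ()
    lemma 1 1 _ _ ()
    lemma (suc (suc _)) _ (s≤s (s≤s ())) _ _
    lemma _ (suc (suc _)) _ (s≤s (s≤s ())) _
  carry : ∀ k l → (k + l + 1) * 2 ≡ (1 + 1) + (k + l) * 2
  carry = solve-∀
  higher : k + l + 1 ≡ 2 ^ s
  higher = *-cancelʳ-≡ (k + l + 1) (2 ^ s) 2 (begin
    (k + l + 1) * 2                  ≡⟨ carry k l ⟩
    (1 + 1) + (k + l) * 2            ≡⟨ cong (λ d → d + 1 + (k + l) * 2) (sym digits-sum-to-1) ⟩
    (b + c + 1) + (k + l) * 2        ≡⟨ total ⟩
    2 ^ s * 2                        ∎)

parity-congˡ : ∀ a b c → a % 2 ≡ b % 2 → (a + c) % 2 ≡ (b + c) % 2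
parity-congˡ a b c a≡b = begin
    (a + c) % 2               ≡⟨ %-distribˡ-+ a c 2 ⟩
    (a % 2 + c % 2) % 2       ≡⟨ cong (λ w → (w + c % 2) % 2) a≡b ⟩
    (b % 2 + c % 2) % 2       ≡⟨ sym (%-distribˡ-+ b c 2) ⟩
    (b + c) % 2               ∎
  where open ≡-Reasoning

parity-congʳ : ∀ a b c → a % 2 ≡ b % 2 → (c + a) % 2 ≡ (c + b) % 2
parity-congʳ a b c a≡b =
  trans (cong (_% 2) (+-comm c a)) (trans (parity-congˡ a b c a≡b) (cong (_% 2) (+-comm b c)))

tm-concat : ∀ {P} q r → PowerOfTwo P → r < P → tm (P * q + r) ≡ (popcount q + popcount r) % 2
tm-concat q r pow r<P = cong (_% 2) (popcount-concat q r pow r<P)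

window : ∀ {P} Q Q' s → PowerOfTwo P → s < 3 * P →
         (∀ u → u < 3 → tm (Q + u) ≡ tm (Q' + u)) → tm (P * Q + s) ≡ tm (P * Q' + s)
window {P} Q Q' s pow@(N , refl) s<3P agree = begin
    tm (P * Q + s)                        ≡⟨ cong tm (split Q) ⟩
    tm (P * (Q + u) + r)                  ≡⟨ tm-concat (Q + u) r pow r<P ⟩
    (popcount (Q + u) + popcount r) % 2   ≡⟨ parity-congˡ (popcount (Q + u)) (popcount (Q' + u)) (popcount r) (agree u u<3) ⟩
    (popcount (Q' + u) + popcount r) % 2  ≡⟨ sym (tm-concat (Q' + u) r pow r<P) ⟩
    tm (P * (Q' + u) + r)                 ≡⟨ cong tm (sym (split Q')) ⟩
    tm (P * Q' + s)                       ∎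
  where
  open ≡-Reasoning
  instance
    P≢0 : NonZero P
    P≢0 = m^n≢0 2 N
  u = s / P
  r = s % P
  r<P : r < P
  r<P = m%n<n s P
  u<3 : u < 3
  u<3 = m<n*o⇒m/o<n s<3P
  distribute : ∀ P Q r u → P * Q + (r + u * P) ≡ P * (Q + u) + r
  distribute = solve-∀
  split : ∀ Q → P * Q + s ≡ P * (Q + u) + r
  split Q = trans (cong (_+_ (P * Q)) (m≡m%n+[m/n]*n s P)) (distribute P Q r u)

nested-window : ∀ {B} q x y z → PowerOfTwo B → x < B → y < B → z < B →
                popcount x % 2 ≡ (popcount y + popcount z) % 2 →
                tm (B * q + x) ≡ tm (B * (B * q + y) + z)
nested-window {B} q x y z pow x<B y<B z<B parity = begin
    tm (B * q + x)                                  ≡⟨ tm-concat q x pow x<B ⟩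
    (popcount q + popcount x) % 2                   ≡⟨ parity-congʳ (popcount x) (popcount y + popcount z) (popcount q) parity ⟩
    (popcount q + (popcount y + popcount z)) % 2    ≡⟨ cong (_% 2) (sym (+-assoc (popcount q) _ _)) ⟩
    (popcount q + popcount y + popcount z) % 2      ≡⟨ cong (λ w → (w + popcount z) % 2) (sym (popcount-concat q y pow y<B)) ⟩
    (popcount (B * q + y) + popcount z) % 2         ≡⟨ sym (tm-concat (B * q + y) z pow z<B) ⟩
    tm (B * (B * q + y) + z)                        ∎
  where open ≡-Reasoning

Γ-witness : ∀ j {k m P} Q Q' c a b → PowerOfTwo P → m % 2 ≡ 1 → a < b → b < k →
            j + a * m ≡ P * Q + c → j + b * m ≡ P * Q' + c → c + m ≤ 3 * P →
            (∀ u → u < 3 → tm (Q + u) ≡ tm (Q' + u)) → ΓGe j k (+ m)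
Γ-witness j {k} {m} {P} Q Q' c a b pow odd a<b b<k start-a start-b room agree =
  m , odd , not-anti-power , ℤP.≤-refl
  where
  open ≡-Reasoning
  same-letter : ∀ i → i < m → tm (j + a * m + i) ≡ tm (j + b * m + i)
  same-letter i i<m = begin
    tm (j + a * m + i)     ≡⟨ cong (λ w → tm (w + i)) start-a ⟩
    tm (P * Q + c + i)     ≡⟨ cong tm (+-assoc (P * Q) c i) ⟩
    tm (P * Q + (c + i))   ≡⟨ window Q Q' (c + i) pow (<-≤-trans (+-monoʳ-< c i<m) room) agree ⟩
    tm (P * Q' + (c + i))  ≡⟨ cong tm (sym (+-assoc (P * Q') c i)) ⟩
    tm (P * Q' + c + i)    ≡⟨ cong (λ w → tm (w + i)) (sym start-b) ⟩
    tm (j + b * m + i)     ∎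
  same-block : block j m a ≡ block j m b
  same-block = tabulate-cong (λ i → same-letter (toℕ i) (toℕ<n i))
  not-anti-power : ¬ InF j k m
  not-anti-power (_ , anti-power) =
    anti-power a b (<-trans a<b b<k) b<k (λ a≡b → <-irrefl a≡b a<b) same-block

small-shift : ∀ x u → u < 3 → x + u ≤ x + 2
small-shift x u u<3 = +-monoʳ-≤ x (≤-pred u<3)

-- The windows of 3A + 2 and A(3A + 2) + 3 agree for every power of two A ≥ 4
-- (for A = 4 by direct computation, for A ≥ 8 by the two-level window).
windowA : ∀ D → PowerOfTwo (4 * suc D) → ∀ u → u < 3 →
          tm (4 * suc D * 3 + 2 + u) ≡ tm (4 * suc D * (4 * suc D * 3 + 2) + 3 + u)
windowA zero _ 0 _ = refl
windowA zero _ 1 _ = refl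
windowA zero _ 2 _ = refl
windowA zero _ (suc (suc (suc _))) (s≤s (s≤s (s≤s ())))
windowA (suc d) pow u u<3 = begin
    tm (A * 3 + 2 + u)              ≡⟨ cong tm (+-assoc (A * 3) 2 u) ⟩
    tm (A * 3 + (2 + u))            ≡⟨ nested-window 3 (2 + u) 2 (3 + u) pow
                                         (below-A (2 + u) (≤-trans (small-shift 2 u u<3) (n≤1+n 4)))
                                         (below-A 2 (s≤s (s≤s z≤n)))
                                         (below-A (3 + u) (small-shift 3 u u<3))
                                         (digit-parity u u<3) ⟩
    tm (A * (A * 3 + 2) + (3 + u))  ≡⟨ cong tm (sym (+-assoc (A * (A * 3 + 2)) 3 u)) ⟩
    tm (A * (A * 3 + 2) + 3 + u)    ∎
  where
  open ≡-Reasoning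
  A = 4 * suc (suc d)
  below-A : ∀ x → x ≤ 5 → x < A
  below-A x x≤5 = ≤-<-trans x≤5 (<-by (2 + 4 * d) (eight-plus d))
    where
    eight-plus : ∀ d → suc (5 + (2 + 4 * d)) ≡ 4 * suc (suc d)
    eight-plus = solve-∀
  digit-parity : ∀ u → u < 3 → popcount (2 + u) % 2 ≡ (popcount 2 + popcount (3 + u)) % 2
  digit-parity 0 _ = refl
  digit-parity 1 _ = refl
  digit-parity 2 _ = refl
  digit-parity (suc (suc (suc _))) (s≤s (s≤s (s≤s ())))

-- With A = 4(D + 1) a power of two and j ≤ D + 1, the blocks
-- a = A + 1 and b = A² + A + 1 of length m = 3A² − A + 1 coincide
-- (both start at A²·Q + j + 1 with Q ∈ {3A + 2, A(3A + 2) + 3}).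
familyA : ∀ j D → PowerOfTwo (4 * suc D) → j ≤ suc D →
          ΓGe j (4 * suc D * (4 * suc D) + 4 * suc D + 2) (+ (48 * D * D + 92 * D + 45))
familyA j D pow j≤D+1 =
  Γ-witness j (A * 3 + 2) (A * (A * 3 + 2) + 3) (1 + j) (A + 1) (A * A + A + 1)
    (powerOfTwo-* pow pow) odd a<b b<k (start-a j D) (start-b j D) room (windowA D pow)
  where
  A = 4 * suc D
  m = 48 * D * D + 92 * D + 45
  odd-form : ∀ D → 48 * D * D + 92 * D + 45 ≡ 1 + (24 * D * D + 46 * D + 22) * 2
  odd-form = solve-∀
  odd : m % 2 ≡ 1
  odd = trans (cong (_% 2) (odd-form D)) ([m+kn]%n≡m%n 1 (24 * D * D + 46 * D + 22) 2)
  a<b-gap : ∀ D → suc (4 * suc D + 1 + (16 * D * D + 32 * D + 15))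
                  ≡ 4 * suc D * (4 * suc D) + 4 * suc D + 1
  a<b-gap = solve-∀
  a<b : A + 1 < A * A + A + 1
  a<b = <-by _ (a<b-gap D)
  b<k-gap : ∀ D → suc (4 * suc D * (4 * suc D) + 4 * suc D + 1 + 0)
                  ≡ 4 * suc D * (4 * suc D) + 4 * suc D + 2
  b<k-gap = solve-∀
  b<k : A * A + A + 1 < A * A + A + 2
  b<k = <-by 0 (b<k-gap D)
  start-a : ∀ j D → j + (4 * suc D + 1) * (48 * D * D + 92 * D + 45)
                    ≡ 4 * suc D * (4 * suc D) * (4 * suc D * 3 + 2) + (1 + j)
  start-a = solve-∀
  start-b : ∀ j D → j + (4 * suc D * (4 * suc D) + 4 * suc D + 1) * (48 * D * D + 92 * D + 45)
                    ≡ 4 * suc D * (4 * suc D) * (4 * suc D * (4 * suc D * 3 + 2) + 3) + (1 + j)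
  start-b = solve-∀
  room-gap : ∀ D → 2 + D + (48 * D * D + 92 * D + 45) + (3 * D + 1) ≡ 3 * (4 * suc D * (4 * suc D))
  room-gap = solve-∀
  room : 1 + j + m ≤ 3 * (A * A)
  room = ≤-trans (+-monoˡ-≤ m (s≤s j≤D+1)) (≤-by (3 * D + 1) (room-gap D))

-- With E = F + 1 a power of two, j ≤ E and 95 ≤ E, the blocks
-- a = 32E + 16 and b = 32E² + 32E + 16 of length m = 96E² − 2E + 1 coincide
-- (both start at 32E²·Q + j + 16 with Q ∈ {96E + 46, E(96E + 94) + 47}).
familyK : ∀ j F → PowerOfTwo (suc F) → j ≤ suc F → 94 ≤ F →
          ΓGe j (32 * (suc F * suc F) + 96 * suc F + 49) (+ (96 * F * F + 190 * F + 95))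
familyK j F pow j≤E 94≤F =
  Γ-witness j (E * 96 + 46) (E * (E * 96 + 94) + 47) (16 + j) (32 * E + 16) (32 * (E * E) + 32 * E + 16)
    (powerOfTwo-* (5 , refl) (powerOfTwo-* pow pow)) odd a<b b<k (start-a j F) (start-b j F) room agree
  where
  open ≡-Reasoning
  E = suc F
  m = 96 * F * F + 190 * F + 95
  odd-form : ∀ F → 96 * F * F + 190 * F + 95 ≡ 1 + (48 * F * F + 95 * F + 47) * 2
  odd-form = solve-∀
  odd : m % 2 ≡ 1
  odd = trans (cong (_% 2) (odd-form F)) ([m+kn]%n≡m%n 1 (48 * F * F + 95 * F + 47) 2)
  a<b-gap : ∀ F → suc (32 * suc F + 16 + (32 * F * F + 64 * F + 31))
                  ≡ 32 * (suc F * suc F) + 32 * suc F + 16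
  a<b-gap = solve-∀
  a<b : 32 * E + 16 < 32 * (E * E) + 32 * E + 16
  a<b = <-by _ (a<b-gap F)
  b<k-gap : ∀ F → suc (32 * (suc F * suc F) + 32 * suc F + 16 + (64 * suc F + 32))
                  ≡ 32 * (suc F * suc F) + 96 * suc F + 49
  b<k-gap = solve-∀
  b<k : 32 * (E * E) + 32 * E + 16 < 32 * (E * E) + 96 * E + 49
  b<k = <-by _ (b<k-gap F)
  start-a : ∀ j F → j + (32 * suc F + 16) * (96 * F * F + 190 * F + 95)
                    ≡ 32 * (suc F * suc F) * (suc F * 96 + 46) + (16 + j)
  start-a = solve-∀
  start-b : ∀ j F → j + (32 * (suc F * suc F) + 32 * suc F + 16) * (96 * F * F + 190 * F + 95)
                    ≡ 32 * (suc F * suc F) * (suc F * (suc F * 96 + 94) + 47) + (16 + j)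
  start-b = solve-∀
  room-exact : ∀ F → F + suc F + (96 * F * F + 190 * F + 95) ≡ 3 * (32 * (suc F * suc F))
  room-exact = solve-∀
  room : 16 + j + m ≤ 3 * (32 * (E * E))
  room = ≤-trans (+-monoˡ-≤ m (+-monoʳ-≤ 16 j≤E))
           (≤-trans (+-monoˡ-≤ m (+-monoˡ-≤ E (≤-trans (m≤m+n 16 78) 94≤F))) (≤-reflexive (room-exact F)))
  below-E : ∀ x → x ≤ 94 → x < E
  below-E x x≤94 = s≤s (≤-trans x≤94 94≤F)
  digit-parity : ∀ u → u < 3 → popcount (46 + u) % 2 ≡ (popcount 94 + popcount (47 + u)) % 2
  digit-parity 0 _ = refl
  digit-parity 1 _ = refl
  digit-parity 2 _ = refl
  digit-parity (suc (suc (suc _))) (s≤s (s≤s (s≤s ())))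
  agree : ∀ u → u < 3 → tm (E * 96 + 46 + u) ≡ tm (E * (E * 96 + 94) + 47 + u)
  agree u u<3 = begin
    tm (E * 96 + 46 + u)              ≡⟨ cong tm (+-assoc (E * 96) 46 u) ⟩
    tm (E * 96 + (46 + u))            ≡⟨ nested-window 96 (46 + u) 94 (47 + u) pow
                                           (below-E (46 + u) (≤-trans (small-shift 46 u u<3) (m≤m+n 48 46)))
                                           (below-E 94 ≤-refl)
                                           (below-E (47 + u) (≤-trans (small-shift 47 u u<3) (m≤m+n 49 45)))
                                           (digit-parity u u<3) ⟩
    tm (E * (E * 96 + 94) + (47 + u)) ≡⟨ cong tm (sym (+-assoc (E * (E * 96 + 94)) 47 u)) ⟩
    tm (E * (E * 96 + 94) + 47 + u)   ∎

-- Let 16(g + x) be a power of two, g have even digit sum and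
-- 2 + j ≤ 16x.  Then the blocks a = 1 and b = 16(g + x) + 1 of length
-- m = 32x + 40g + 1 coincide (both start at 16(g + x)·Q + 8g + j + 1 with
-- Q ∈ {2, 32(g + x) + 8g + 3}).
familyC : ∀ j g x → PowerOfTwo (16 * (g + x)) → 2 + j ≤ 16 * x → popcount g % 2 ≡ 0 →
          ΓGe j (16 * (g + x) + 2) (+ (32 * x + 40 * g + 1))
familyC j g zero _ ()
familyC j g x@(suc y) pow 2+j≤16x even =
  Γ-witness j 2 (C * 2 + (8 * g + 3)) (8 * g + 1 + j) 1 (1 + C)
    pow odd a<b b<k (start-a j g x) (start-b j g x) room agree
  where
  open ≡-Reasoning
  C = 16 * (g + x)
  m = 32 * x + 40 * g + 1
  odd-form : ∀ g x → 32 * x + 40 * g + 1 ≡ 1 + (16 * x + 20 * g) * 2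
  odd-form = solve-∀
  odd : m % 2 ≡ 1
  odd = trans (cong (_% 2) (odd-form g x)) ([m+kn]%n≡m%n 1 (16 * x + 20 * g) 2)
  a<b-gap : ∀ g y → suc (1 + (16 * g + 16 * y + 15)) ≡ 1 + 16 * (g + suc y)
  a<b-gap = solve-∀
  a<b : 1 < 1 + C
  a<b = <-by _ (a<b-gap g y)
  b<k : 1 + C < C + 2
  b<k = <-by 0 (b<k-gap C)
    where
    b<k-gap : ∀ C → suc (1 + C + 0) ≡ C + 2
    b<k-gap = solve-∀
  start-a : ∀ j g x → j + 1 * (32 * x + 40 * g + 1) ≡ 16 * (g + x) * 2 + (8 * g + 1 + j)
  start-a = solve-∀
  start-b : ∀ j g x → j + (1 + 16 * (g + x)) * (32 * x + 40 * g + 1)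
                      ≡ 16 * (g + x) * (16 * (g + x) * 2 + (8 * g + 3)) + (8 * g + 1 + j)
  start-b = solve-∀
  room-split : ∀ j g x → 8 * g + 1 + j + (32 * x + 40 * g + 1) ≡ (2 + j) + (48 * g + 32 * x)
  room-split = solve-∀
  room-merge : ∀ g x → 16 * x + (48 * g + 32 * x) ≡ 3 * (16 * (g + x))
  room-merge = solve-∀
  room : 8 * g + 1 + j + m ≤ 3 * C
  room = ≤-trans (≤-reflexive (room-split j g x))
           (≤-trans (+-monoˡ-≤ (48 * g + 32 * x) 2+j≤16x) (≤-reflexive (room-merge g x)))
  tail<C-gap : ∀ g y → suc (8 * g + 5 + (8 * g + 16 * y + 10)) ≡ 16 * (g + suc y)
  tail<C-gap = solve-∀
  tail<C : ∀ u → u < 3 → 8 * g + (3 + u) < C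
  tail<C u u<3 = ≤-<-trans (+-monoʳ-≤ (8 * g) (small-shift 3 u u<3))
                   (<-by _ (tail<C-gap g y))
  5<8 : 5 < 8
  5<8 = <-by 2 refl
  digit-parity : ∀ u → u < 3 → (1 + popcount (3 + u)) % 2 ≡ popcount (2 + u) % 2
  digit-parity 0 _ = refl
  digit-parity 1 _ = refl
  digit-parity 2 _ = refl
  digit-parity (suc (suc (suc _))) (s≤s (s≤s (s≤s ())))
  agree : ∀ u → u < 3 → tm (2 + u) ≡ tm (C * 2 + (8 * g + 3) + u)
  agree u u<3 = sym (begin
    tm (C * 2 + (8 * g + 3) + u)                      ≡⟨ cong tm (regroup u) ⟩
    tm (C * 2 + (8 * g + (3 + u)))                    ≡⟨ tm-concat 2 (8 * g + (3 + u)) pow (tail<C u u<3) ⟩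
    (1 + popcount (8 * g + (3 + u))) % 2              ≡⟨ cong (λ w → (1 + w) % 2)
                                                           (popcount-concat g (3 + u) (3 , refl) (≤-<-trans (small-shift 3 u u<3) 5<8)) ⟩
    (1 + (popcount g + popcount (3 + u))) % 2         ≡⟨ parity-congʳ (popcount g + popcount (3 + u)) (popcount (3 + u)) 1
                                                           (parity-congˡ (popcount g) 0 (popcount (3 + u)) even) ⟩
    (1 + popcount (3 + u)) % 2                        ≡⟨ digit-parity u u<3 ⟩
    tm (2 + u)                                        ∎)
    where
    regroup : ∀ u → C * 2 + (8 * g + 3) + u ≡ C * 2 + (8 * g + (3 + u))
    regroup u = trans (+-assoc (C * 2) _ u) (cong (_+_ (C * 2)) (+-assoc (8 * g) 3 u))

≤-2^⌈log2⌉ : ∀ n (rec : Acc _<_ n) → n ≤ 2 ^ ⌈log2⌉ n rec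
≤-2^⌈log2⌉ zero _ = z≤n
≤-2^⌈log2⌉ (suc zero) _ = s≤s z≤n
≤-2^⌈log2⌉ (suc (suc n)) (acc rs) = begin
    suc (suc n)                              ≤⟨ s≤s (s≤s n≤2⌈n/2⌉) ⟩
    suc (suc (h + h))                        ≡⟨ doubled h ⟩
    2 * suc h                                ≤⟨ *-monoʳ-≤ 2 (≤-2^⌈log2⌉ (suc h) (rs (⌈n/2⌉<n n))) ⟩
    2 * 2 ^ ⌈log2⌉ (suc h) (rs (⌈n/2⌉<n n))  ∎
  where
  open ≤-Reasoning
  h = ⌈ n /2⌉
  n≤2⌈n/2⌉ : n ≤ h + h
  n≤2⌈n/2⌉ = ≤-trans (≤-reflexive (sym (⌊n/2⌋+⌈n/2⌉≡n n))) (+-monoˡ-≤ h (⌊n/2⌋≤⌈n/2⌉ n))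
  doubled : ∀ h → suc (suc (h + h)) ≡ 2 * suc h
  doubled = solve-∀

scale-bound : ∀ j t α → ⌈log₂ j ⌉ + t ≤ α → Σ ℕ λ s → (α ≡ t + s) × (j ≤ 2 ^ s)
scale-bound j t α c+t≤α with m≤n⇒∃[o]m+o≡n c+t≤α
... | e , c+t+e≡α =
  c + e , trans (sym c+t+e≡α) (reorder c t e) ,
  ≤-trans (≤-2^⌈log2⌉ j (<-wellFounded j)) (^-monoʳ-≤ 2 (m≤m+n c e))
  where
  c = ⌈log₂ j ⌉
  reorder : ∀ c t e → c + t + e ≡ t + (c + e)
  reorder = solve-∀

pow-suc : ∀ n → Σ ℕ λ D → 2 ^ n ≡ suc D
pow-suc n with 2 ^ n | m^n>0 2 n
... | suc D | _ = D , refl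

pow-split : ∀ a b {n} → a + b ≡ n → 2 ^ n ≡ 2 ^ a * 2 ^ b
pow-split a b refl = ^-distribˡ-+-* 2 a b

pow-double : ∀ n → 2 ^ (2 * n) ≡ 2 ^ n * 2 ^ n
pow-double n = pow-split n n (double n)
  where
  double : ∀ n → n + n ≡ 2 * n
  double = solve-∀

minus-plus-one : ∀ x y z → x + 1 ≡ z + y → + x ℤ.- + y ℤ.+ + 1 ≡ + z
minus-plus-one x y z x+1≡z+y = begin
    + x ℤ.- + y ℤ.+ + 1        ≡⟨ ℤP.+-assoc (+ x) (ℤ.- + y) (+ 1) ⟩
    + x ℤ.+ (ℤ.- + y ℤ.+ + 1)  ≡⟨ cong (ℤ._+_ (+ x)) (ℤP.+-comm (ℤ.- + y) (+ 1)) ⟩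
    + x ℤ.+ (+ 1 ℤ.- + y)      ≡⟨ sym (ℤP.+-assoc (+ x) (+ 1) (ℤ.- + y)) ⟩
    + (x + 1) ℤ.- + y          ≡⟨ cong (λ w → + w ℤ.- + y) x+1≡z+y ⟩
    + (z + y) ℤ.- + y          ≡⟨ cong (ℤ._- + y) (ℤP.pos-+ z y) ⟩
    + z ℤ.+ + y ℤ.- + y        ≡⟨ ℤP.+-assoc (+ z) (+ y) (ℤ.- + y) ⟩
    + z ℤ.+ (+ y ℤ.- + y)      ≡⟨ cong (ℤ._+_ (+ z)) (ℤP.+-inverseʳ (+ y)) ⟩
    + z ℤ.+ + 0                ≡⟨ ℤP.+-identityʳ (+ z) ⟩
    + z                        ∎
  where open ≡-Reasoning

χ-spec : ∀ j ρ → Σ ℕ λ z → (χ j ρ ≡ suc z) × (2 * j ≤ z) × (z ≤ 4 * j + 2) × ((popcount z + ρ) % 2 ≡ 0)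
χ-spec j ρ = by-parity ((popcount j + ρ) % 2) refl (m%n<n (popcount j + ρ) 2)
  where
  succ-2j : ∀ j → 2 * j + 1 ≡ suc (j * 2)
  succ-2j = solve-∀
  succ-4j : ∀ j → 4 * j + 3 ≡ suc (4 * j + 2)
  succ-4j = solve-∀
  shuffle : ∀ a b → a + 1 + b ≡ 1 + (a + b)
  shuffle = solve-∀
  popcount-4j+2 : popcount (4 * j + 2) ≡ popcount j + 1
  popcount-4j+2 = popcount-concat j 2 (2 , refl) (<-by 1 refl)
  by-parity : ∀ w → (popcount j + ρ) % 2 ≡ w → w < 2 →
              Σ ℕ λ z → (χ-aux w j ≡ suc z) × (2 * j ≤ z) × (z ≤ 4 * j + 2) × ((popcount z + ρ) % 2 ≡ 0)
  by-parity 0 even _ =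
    j * 2 , succ-2j j , ≤-reflexive (*-comm 2 j) ,
    ≤-trans (≤-reflexive (*-comm j 2)) (≤-trans (*-monoˡ-≤ j {2} {4} (≤-by 2 refl)) (m≤m+n (4 * j) 2)) ,
    trans (cong (λ p → (p + ρ) % 2) (popcount-bit 0 j (<-by 1 refl))) even
  by-parity 1 odd _ =
    4 * j + 2 , succ-4j j ,
    ≤-trans (*-monoˡ-≤ j {2} {4} (≤-by 2 refl)) (m≤m+n (4 * j) 2) , ≤-refl ,
    trans (cong (λ p → (p + ρ) % 2) popcount-4j+2)
      (trans (cong (_% 2) (shuffle (popcount j) ρ)) (parity-congʳ (popcount j + ρ) 1 1 odd))
  by-parity (suc (suc _)) _ (s≤s (s≤s ()))

-- The bound for k_α: take A = 2^α = 4(D + 1) with D + 1 = 2^(α−2) ≥ j.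
bound-k : ∀ j α → ⌈log₂ j ⌉ + 2 ≤ α →
          ΓGe j (k-α α) (+ (3 * 2 ^ (2 * α)) ℤ.- + (2 ^ α) ℤ.+ + 1)
bound-k j α c+2≤α with scale-bound j 2 α c+2≤α
... | s , refl , j≤2^s with pow-suc s
... | D , 2^s≡1+D =
  subst₂ (ΓGe j) (sym k≡) (sym bound≡) (familyA j D (2 + s , A≡) (subst (j ≤_) 2^s≡1+D j≤2^s))
  where
  open ≡-Reasoning
  A≡ : 2 ^ (2 + s) ≡ 4 * suc D
  A≡ = trans (pow-split 2 s refl) (cong (_*_ 4) 2^s≡1+D)
  A²≡ : 2 ^ (2 * (2 + s)) ≡ 4 * suc D * (4 * suc D)
  A²≡ = trans (pow-double (2 + s)) (cong₂ _*_ A≡ A≡)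
  k≡ : k-α (2 + s) ≡ 4 * suc D * (4 * suc D) + 4 * suc D + 2
  k≡ = cong₂ (λ a b → a + b + 2) A²≡ A≡
  identity : ∀ D → 3 * (4 * suc D * (4 * suc D)) + 1 ≡ (48 * D * D + 92 * D + 45) + 4 * suc D
  identity = solve-∀
  bound≡ : + (3 * 2 ^ (2 * (2 + s))) ℤ.- + (2 ^ (2 + s)) ℤ.+ + 1 ≡ + (48 * D * D + 92 * D + 45)
  bound≡ = minus-plus-one _ _ _ (begin
    3 * 2 ^ (2 * (2 + s)) + 1               ≡⟨ cong (λ a → 3 * a + 1) A²≡ ⟩
    3 * (4 * suc D * (4 * suc D)) + 1       ≡⟨ identity D ⟩
    48 * D * D + 92 * D + 45 + 4 * suc D    ≡⟨ cong (_+_ (48 * D * D + 92 * D + 45)) (sym A≡) ⟩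
    48 * D * D + 92 * D + 45 + 2 ^ (2 + s)  ∎)

-- The bound for K_β: take E = 2^(β−2) = F + 1 ≥ 128j.
bound-K : ∀ j β → ⌈log₂ j ⌉ + 9 ≤ β →
          ΓGe j (K-β β) (+ (3 * 2 ^ (2 * β + 1)) ℤ.- + (2 ^ (β ∸ 1)) ℤ.+ + 1)
bound-K j β c+9≤β with scale-bound j 9 β c+9≤β
... | s , refl , j≤2^s with pow-suc s
... | D , 2^s≡1+D =
  subst₂ (ΓGe j) (sym K≡) (sym bound≡) (familyK j F (7 + s , E≡) j≤E (≤-trans (m≤m+n 94 33) (m≤m+n 127 (128 * D))))
  where
  open ≡-Reasoning
  F = 127 + 128 * D
  scaled : ∀ D → 128 * suc D ≡ suc (127 + 128 * D)
  scaled = solve-∀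
  E≡ : 2 ^ (7 + s) ≡ suc F
  E≡ = trans (pow-split 7 s refl) (trans (cong (_*_ 128) 2^s≡1+D) (scaled D))
  j≤E : j ≤ suc F
  j≤E = ≤-trans j≤2^s (≤-trans (≤-reflexive 2^s≡1+D) (≤-trans (m≤n*m (suc D) 128) (≤-reflexive (scaled D))))
  exponent-P : ∀ s → 5 + 2 * (7 + s) ≡ 2 * (9 + s) + 1
  exponent-P = solve-∀
  exponent-mid : ∀ s → 5 + (7 + s) ≡ 9 + s + 3
  exponent-mid = solve-∀
  P≡ : 2 ^ (2 * (9 + s) + 1) ≡ 32 * (suc F * suc F)
  P≡ = trans (pow-split 5 (2 * (7 + s)) (exponent-P s)) (cong (_*_ 32) (trans (pow-double (7 + s)) (cong₂ _*_ E≡ E≡)))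
  three-32 : ∀ E → 3 * (32 * E) ≡ 96 * E
  three-32 = solve-∀
  mid≡ : 3 * 2 ^ (9 + s + 3) ≡ 96 * suc F
  mid≡ = trans (cong (_*_ 3) (trans (pow-split 5 (7 + s) (exponent-mid s)) (cong (_*_ 32) E≡))) (three-32 (suc F))
  K≡ : K-β (9 + s) ≡ 32 * (suc F * suc F) + 96 * suc F + 49
  K≡ = cong₂ (λ a b → a + b + 49) P≡ mid≡
  identity : ∀ F → 3 * (32 * (suc F * suc F)) + 1 ≡ (96 * F * F + 190 * F + 95) + 2 * suc F
  identity = solve-∀
  bound≡ : + (3 * 2 ^ (2 * (9 + s) + 1)) ℤ.- + (2 ^ (9 + s ∸ 1)) ℤ.+ + 1 ≡ + (96 * F * F + 190 * F + 95)
  bound≡ = minus-plus-one _ _ _ (begin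
    3 * 2 ^ (2 * (9 + s) + 1) + 1             ≡⟨ cong (λ a → 3 * a + 1) P≡ ⟩
    3 * (32 * (suc F * suc F)) + 1            ≡⟨ identity F ⟩
    96 * F * F + 190 * F + 95 + 2 * suc F     ≡⟨ cong (λ e → 96 * F * F + 190 * F + 95 + 2 * e) (sym E≡) ⟩
    96 * F * F + 190 * F + 95 + 2 ^ (8 + s)   ∎)

-- The bound for κ_ρ: with x = χ_j(ρ) and 2^(ρ−4) = g + x, the complement g of
-- x − 1 has digit sum (ρ − 4) − s₂(x − 1), which is even by the choice of χ.
bound-κ : ∀ j ρ → ⌈log₂ j ⌉ + 8 ≤ ρ →
          ΓGe j (κ-ρ ρ) (+ (5 * 2 ^ (ρ ∸ 1)) ℤ.- + (8 * χ j ρ) ℤ.+ + 1)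
bound-κ j ρ c+8≤ρ with scale-bound j 8 ρ c+8≤ρ
... | s , refl , j≤2^s with χ-spec j (8 + s)
... | z , χ≡ , 2j≤z , z≤4j+2 , parity-z =
  subst₂ (ΓGe j) (sym κ≡) (sym bound≡) (familyC j g x pow 2+j≤16x even-g)
  where
  x = suc z
  M = 2 ^ (4 + s)
  small-χ : ∀ p → suc (4 * suc p + 2) ≤ 16 * suc p
  small-χ p = ≤-by (12 * p + 9) (gap p)
    where
    gap : ∀ p → suc (4 * suc p + 2 + (12 * p + 9)) ≡ 16 * suc p
    gap = solve-∀
  x≤M : x ≤ M
  x≤M with pow-suc s
  ... | p , 2^s≡1+p = begin
    suc z                ≤⟨ s≤s z≤4j+2 ⟩
    suc (4 * j + 2)      ≤⟨ s≤s (+-monoˡ-≤ 2 (*-monoʳ-≤ 4 (subst (j ≤_) 2^s≡1+p j≤2^s))) ⟩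
    suc (4 * suc p + 2)  ≤⟨ small-χ p ⟩
    16 * suc p           ≡⟨ cong (_*_ 16) (sym 2^s≡1+p) ⟩
    16 * 2 ^ s           ≡⟨ sym (pow-split 4 s refl) ⟩
    M                    ∎
    where open ≤-Reasoning
  g = M ∸ x
  g+x≡M : g + x ≡ M
  g+x≡M = m∸n+n≡m x≤M
  pow : PowerOfTwo (16 * (g + x))
  pow = 8 + s , trans (pow-split 4 (4 + s) refl) (cong (_*_ 16) (sym g+x≡M))
  2+j≤16x : 2 + j ≤ 16 * x
  2+j≤16x = ≤-trans (+-monoʳ-≤ 2 (≤-trans (m≤m+n j (j + 0)) 2j≤z)) (≤-by (14 + 15 * z) (gap z))
    where
    gap : ∀ z → 2 + z + (14 + 15 * z) ≡ 16 * suc z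
    gap = solve-∀
  complement : popcount g + popcount z ≡ 4 + s
  complement = popcount-complement (4 + s) g z (trans (+-assoc g z 1) (trans (cong (_+_ g) (+-comm z 1)) g+x≡M))
  twice : ∀ s → 4 + s + (8 + s) ≡ (s + 6) * 2
  twice = solve-∀
  total-even : popcount g + (popcount z + (8 + s)) ≡ (s + 6) * 2
  total-even = trans (sym (+-assoc (popcount g) (popcount z) (8 + s)))
                 (trans (cong (_+ (8 + s)) complement) (twice s))
  even-g : popcount g % 2 ≡ 0
  even-g = begin
    popcount g % 2                                ≡⟨ cong (_% 2) (sym (+-identityʳ (popcount g))) ⟩
    (popcount g + 0) % 2                          ≡⟨ sym (parity-congʳ (popcount z + (8 + s)) 0 (popcount g) parity-z) ⟩
    (popcount g + (popcount z + (8 + s))) % 2     ≡⟨ cong (_% 2) total-even ⟩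
    ((s + 6) * 2) % 2                             ≡⟨ m*n%n≡0 (s + 6) 2 ⟩
    0                                             ∎
    where open ≡-Reasoning
  κ≡ : κ-ρ (8 + s) ≡ 16 * (g + x) + 2
  κ≡ = cong (_+ 2) (proj₂ pow)
  identity : ∀ g x → 5 * (8 * (g + x)) + 1 ≡ (32 * x + 40 * g + 1) + 8 * x
  identity = solve-∀
  bound≡ : + (5 * 2 ^ (8 + s ∸ 1)) ℤ.- + (8 * χ j (8 + s)) ℤ.+ + 1 ≡ + (32 * x + 40 * g + 1)
  bound≡ = minus-plus-one _ _ _ (begin
    5 * 2 ^ (7 + s) + 1                        ≡⟨ cong (λ a → 5 * a + 1) (trans (pow-split 3 (4 + s) refl) (cong (_*_ 8) (sym g+x≡M))) ⟩
    5 * (8 * (g + x)) + 1                      ≡⟨ identity g x ⟩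
    32 * x + 40 * g + 1 + 8 * x                ≡⟨ cong (λ w → 32 * x + 40 * g + 1 + 8 * w) (sym χ≡) ⟩
    32 * x + 40 * g + 1 + 8 * χ j (8 + s)      ∎)
    where open ≡-Reasoning

-- Theorem 20: the three lower bounds on Γ_j.
mainTheorem20 : ∀ (j : ℕ) → 1 ≤ j →
    (∀ α → ⌈log₂ j ⌉ + 2 ≤ α →
       ΓGe j (k-α α) (+ (3 * 2 ^ (2 * α)) ℤ.- + (2 ^ α) ℤ.+ + 1))
  × (∀ β → ⌈log₂ j ⌉ + 9 ≤ β →
       ΓGe j (K-β β) (+ (3 * 2 ^ (2 * β + 1)) ℤ.- + (2 ^ (β ∸ 1)) ℤ.+ + 1))
  × (∀ ρ → ⌈log₂ j ⌉ + 8 ≤ ρ →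
       ΓGe j (κ-ρ ρ) (+ (5 * 2 ^ (ρ ∸ 1)) ℤ.- + (8 * χ j ρ) ℤ.+ + 1))
mainTheorem20 j _ = bound-k j , bound-K j , bound-κ j
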